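{- Let $w, s, m_0, m_1, \ldots, m_s$ be positive integers with $w \le \sum_{i=0}^s m_i$, and let $F$ be a set consisting of a single state. The Cards in Piles puzzle $C(w,s,m_0,\ldots,m_s;F)$ can always be solved when $w=1$. When $w>1$, the puzzle can always be solved except in the following two situations: (1) $s=1$; (2) $\sum_{i=0}^s m_i < w + \max\{m_i : 0\le i\le s\}$.
   Context: Cards in Piles: there is a set $W$ of $w$ distinct cards and $s+1$ piles numbered $0,\ldots,s$. A state is a tuple $(P_0,\ldots,P_s)$ of ordered subsets of $W$ (each read from bottom to top) that partition $W$, with $|P_i|\le m_i$ for each $i$. A move takes the top card of one pile and places it on top of another pile, provided the result is a state (no pile $i$ exceeds $m_i$ cards). The Cards in Piles graph $G(w,s,m_0,\ldots,m_s)$ is the undirected graph whose vertices are states and whose edges are moves. In the puzzle $C(w,s,m_0,\ldots,m_s;F)$ every state is a starting state and $F$ is a set containing one finishing state; the puzzle can always be solved if from every state there is a sequence of moves reaching the finishing state. -}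

module Defs where

open import Data.Nat using (ℕ; _≤_; _⊔_)
open import Data.Fin using (Fin)
open import Data.List using (List; []; _∷_; length; concat; allFin)
open import Data.List.Relation.Binary.Permutation.Propositional using (_↭_)
open import Data.Vec using (Vec; lookup; toList; _[_]≔_; foldr′)
open import Data.Product using (Σ; _×_; ∃; ∃-syntax)
open import Relation.Binary.PropositionalEquality using (_≡_; _≢_)
open import Relation.Binary.Construct.Closure.ReflexiveTransitive using (Star)

-- Cards are Fin w; piles are indexed by Fin (suc s) (piles 0..s).
-- A pile is a List of cards whose HEAD is the TOP card (the list reads top to bottom).
Config : ℕ → ℕ → Set
Config w s = Vec (List (Fin w)) s

IsState : ∀ {w s} → Vec ℕ s → Config w s → Set
IsState {w} m P =
  (concat (toList P) ↭ allFin w) × (∀ i → length (lookup P i) ≤ lookup m i)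

Move : ∀ {w s} → Vec ℕ s → Config w s → Config w s → Set
Move m P Q =
  IsState m P × IsState m Q ×
  ∃[ i ] ∃[ j ] (i ≢ j × ∃[ c ] ∃[ rest ]
    (lookup P i ≡ c ∷ rest ×
     Q ≡ (P [ i ]≔ rest) [ j ]≔ (c ∷ lookup P j)))

Reachable : ∀ {w s} → Vec ℕ s → Config w s → Config w s → Set
Reachable m = Star (Move m)

AlwaysSolvable : ∀ {w s} → Vec ℕ s → Config w s → Set
AlwaysSolvable m f = ∀ P → IsState m P → Reachable m P f

sumV : ∀ {n} → Vec ℕ n → ℕ
sumV = foldr′ Data.Nat._+_ 0
  where import Data.Nat

maxV : ∀ {n} → Vec ℕ n → ℕ
maxV = foldr′ _⊔_ 0

-- Sufficiency is by induction on the number of cards.  Fix the bottom card x of a pile p of the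
-- finishing state.  From any state, x can be brought alone onto pile p: empty p (since
-- w + m_i ≤ Σ m there is always room on another pile), dig x out of its pile q, and drop it on p.
-- If digging fills every pile but p and q, a third pile of positive capacity lets x be parked
-- while p is poured onto q.  From then on x never moves, so what remains is the puzzle with
-- w − 1 cards and m_p lowered by one, which again satisfies the hypotheses.
-- For necessity: with two piles, the cards read down pile 0 and up pile 1 never change order;
-- and if Σ m < w + m_p, pile p can never be emptied, so its bottom card never changes.  Either
-- way, swapping two cards of the finishing state yields a state from which it is unreachable.

module Submission where

open import Defs

import Algebra.Properties.CommutativeMonoid.Sum
open import Data.Empty using (⊥-elim)
open import Data.Fin using (Fin; zero; suc; fromℕ<)
open import Data.Fin.Permutation using (Permutation′; _⟨$⟩ʳ_; _⟨$⟩ˡ_; inverseˡ; inverseʳ; transpose)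
import Data.Fin.Properties as Finₚ
open Finₚ using (any?) renaming (_≟_ to _≟ᶠ_)
open import Data.List using (List; []; _∷_; length; concat; _++_; [_]; initLast; _∷ʳ′_; map; reverse; allFin)
open import Data.List.Properties
  using (length-++; ++-assoc; ++-identityʳ; length-map; length-tabulate; map-++; reverse-map; unfold-reverse;
         concat-map; ∷-injective; ∷ʳ-injectiveʳ)
open import Data.List.Membership.Propositional using (_∈_)
open import Data.List.Membership.Propositional.Properties using (∈-++⁻; ∈-∃++; ∈-allFin; ∈-map⁺)
open import Data.List.Membership.Propositional.Properties.WithK using (unique∧set⇒bag)
open import Data.List.Relation.Binary.BagAndSetEquality using (∼bag⇒↭)
open import Data.List.Relation.Binary.Permutation.Propositional
  using (_↭_; ↭-refl; ↭-sym; ↭-trans; ↭-reflexive; prep; module PermutationReasoning)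
open import Data.List.Relation.Binary.Permutation.Propositional.Properties
  using (↭-length; ∈-resp-↭; ++⁺ˡ; ++⁺ʳ; shift; shifts; drop-∷; ↭-reverse) renaming (map⁺ to ↭-map⁺)
open import Data.List.Relation.Unary.Any using (here; there)
open import Data.List.Relation.Unary.Unique.Propositional.Properties using (allFin⁺) renaming (map⁺ to unique-map⁺)
open import Data.Nat using (ℕ; zero; suc; _≤_; _<_; _+_; _∸_; _⊓_; z≤n; s≤s; _≤?_)
open import Data.Nat.Properties
open import Algebra.Properties.CommutativeSemigroup +-commutativeSemigroup using (xy∙z≈zy∙x; xy∙z≈xz∙y)
import Data.Product
open Data.Product using (_×_; _,_; proj₁; proj₂; ∃; ∃₂)
open import Data.Sum using (_⊎_; inj₁; inj₂; map₂)
import Data.Vec as Vec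
open Vec using (Vec; []; _∷_; lookup; toList; _[_]≔_)
open import Data.Vec.Properties
  using (lookup∘update; lookup∘update′; []≔-lookup; []≔-commutes; []≔-idempotent; tabulate∘lookup; tabulate-cong;
         lookup-map; toList-map)
open import Data.Vec.Functional using (updateAt)
open import Data.Vec.Functional.Properties using (updateAt-updates; updateAt-minimal)
open import Function using (_∘_; const; id; case_of_)
open import Function.Bundles using (_⇔_; mk⇔)
open import Relation.Binary.Construct.Closure.ReflexiveTransitive using (Star; ε; _◅_; _◅◅_)
open import Relation.Binary.PropositionalEquality hiding ([_])
open import Relation.Nullary using (¬_; Dec; yes; no; contradiction)
open import Relation.Nullary.Decidable using (¬?; _×-dec_; dec-true)

open Algebra.Properties.CommutativeMonoid.Sum +-0-commutativeMonoid
  using (sum; sum-cong-≗; ∑-distrib-+; sum-replicate-zero)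

private variable
  n w : ℕ
  p q : Fin n
  c : Vec ℕ n

another : 2 ≤ n → ∀ (b : Fin n) → ∃ λ a → a ≢ b
another (s≤s (s≤s _)) zero    = suc zero , λ ()
another (s≤s (s≤s _)) (suc _) = zero , λ ()

sum-mono-≤ : ∀ {f g : Fin n → ℕ} → (∀ k → f k ≤ g k) → sum f ≤ sum g
sum-mono-≤ {n = zero}  f≤g = z≤n
sum-mono-≤ {n = suc n} f≤g = +-mono-≤ (f≤g zero) (sum-mono-≤ (f≤g ∘ suc))

point≤sum : ∀ (f : Fin n → ℕ) p → f p ≤ sum f
point≤sum f zero    = m≤m+n _ _
point≤sum f (suc p) = ≤-trans (point≤sum (f ∘ suc) p) (m≤n+m _ _)

sum-updateAt : ∀ (f : Fin n → ℕ) p v → sum (updateAt f p (const v)) + f p ≡ sum f + v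
sum-updateAt f zero    v = xy∙z≈zy∙x v (sum (f ∘ suc)) (f zero)
sum-updateAt f (suc p) v = begin
  f zero + sum (updateAt (f ∘ suc) p (const v)) + f (suc p)
    ≡⟨ +-assoc (f zero) _ _ ⟩
  f zero + (sum (updateAt (f ∘ suc) p (const v)) + f (suc p))
    ≡⟨ cong (f zero +_) (sum-updateAt (f ∘ suc) p v) ⟩
  f zero + (sum (f ∘ suc) + v)
    ≡⟨ +-assoc (f zero) _ v ⟨
  f zero + sum (f ∘ suc) + v ∎
  where open ≡-Reasoning

sum-mono-except : ∀ (f g : Fin n → ℕ) p → (∀ k → k ≢ p → f k ≤ g k) →
  sum f + g p ≤ sum g + f p
sum-mono-except f g zero f≤g = begin
  f zero + sum (f ∘ suc) + g zero ≡⟨ xy∙z≈zy∙x (f zero) _ (g zero) ⟩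
  g zero + sum (f ∘ suc) + f zero
    ≤⟨ +-monoˡ-≤ (f zero) (+-monoʳ-≤ (g zero) (sum-mono-≤ (λ k → f≤g (suc k) λ ()))) ⟩
  g zero + sum (g ∘ suc) + f zero ∎
  where open ≤-Reasoning
sum-mono-except f g (suc p) f≤g = begin
  f zero + sum (f ∘ suc) + g (suc p)   ≡⟨ +-assoc (f zero) _ _ ⟩
  f zero + (sum (f ∘ suc) + g (suc p)) ≤⟨ +-mono-≤ (f≤g zero λ ()) tail≤ ⟩
  g zero + (sum (g ∘ suc) + f (suc p)) ≡⟨ +-assoc (g zero) _ _ ⟨
  g zero + sum (g ∘ suc) + f (suc p)   ∎
  where
  open ≤-Reasoning
  tail≤ = sum-mono-except (f ∘ suc) (g ∘ suc) p (λ k k≢p → f≤g (suc k) (k≢p ∘ Finₚ.suc-injective))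

sum-mono-except₂ : ∀ (f g : Fin n → ℕ) {p q} → p ≢ q → (∀ k → k ≢ p → k ≢ q → f k ≤ g k) →
  sum f + g p + g q ≤ sum g + f p + f q
sum-mono-except₂ f g {p} {q} p≢q f≤g = begin
  sum f + g p + g q   ≡⟨ xy∙z≈xz∙y (sum f) (g p) (g q) ⟩
  sum f + g q + g p   ≡⟨ cong (_+ g p) (sum-updateAt f q (g q)) ⟨
  sum f′ + f q + g p  ≡⟨ xy∙z≈xz∙y (sum f′) (f q) (g p) ⟩
  sum f′ + g p + f q  ≤⟨ +-monoˡ-≤ (f q) (sum-mono-except f′ g p f′≤g) ⟩
  sum g + f′ p + f q  ≡⟨ cong (λ z → sum g + z + f q) (updateAt-minimal p q f p≢q) ⟩
  sum g + f p + f q   ∎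
  where
  open ≤-Reasoning
  f′ = updateAt f q (const (g q))
  f′≤g : ∀ k → k ≢ p → f′ k ≤ g k
  f′≤g k k≢p with k ≟ᶠ q
  ... | yes refl = ≤-reflexive (updateAt-updates k f)
  ... | no k≢q   = ≤-trans (≤-reflexive (updateAt-minimal k q f k≢q)) (f≤g k k≢p k≢q)

pair≤sum : ∀ (f : Fin n → ℕ) {p q} → p ≢ q → f p + f q ≤ sum f
pair≤sum {n} f {p} {q} p≢q = begin
  f p + f q            ≡⟨ cong (λ z → z + f p + f q) (sum-replicate-zero n) ⟨
  sum {n} (const 0) + f p + f q ≤⟨ sum-mono-except₂ (const 0) f p≢q (λ _ _ _ → z≤n) ⟩
  sum f + 0 + 0        ≡⟨ cong (_+ 0) (+-identityʳ _) ⟩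
  sum f + 0            ≡⟨ +-identityʳ _ ⟩
  sum f                ∎
  where open ≤-Reasoning

sum-[]≔ : ∀ (h : ℕ → ℕ) (c : Vec ℕ n) p v →
  sum (h ∘ lookup (c [ p ]≔ v)) + h (lookup c p) ≡ sum (h ∘ lookup c) + h v
sum-[]≔ h (x ∷ c) zero    v = xy∙z≈zy∙x (h v) _ (h x)
sum-[]≔ h (x ∷ c) (suc p) v = begin
  h x + sum (h ∘ lookup (c [ p ]≔ v)) + h (lookup c p)   ≡⟨ +-assoc (h x) _ _ ⟩
  h x + (sum (h ∘ lookup (c [ p ]≔ v)) + h (lookup c p)) ≡⟨ cong (h x +_) (sum-[]≔ h c p v) ⟩
  h x + (sum (h ∘ lookup c) + h v)                       ≡⟨ +-assoc (h x) _ _ ⟨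
  h x + sum (h ∘ lookup c) + h v                         ∎
  where open ≡-Reasoning

sumV≡sum : ∀ (c : Vec ℕ n) → sumV c ≡ sum (lookup c)
sumV≡sum []      = refl
sumV≡sum (x ∷ c) = cong (x +_) (sumV≡sum c)

lookup≤maxV : ∀ (c : Vec ℕ n) k → lookup c k ≤ maxV c
lookup≤maxV (x ∷ c) zero    = m≤m⊔n x (maxV c)
lookup≤maxV (x ∷ c) (suc k) = ≤-trans (lookup≤maxV c k) (m≤n⊔m x (maxV c))

maxV-attained : ∀ (c : Vec ℕ (suc n)) → ∃ λ p → lookup c p ≡ maxV c
maxV-attained (x ∷ []) = zero , sym (⊔-identityʳ x)
maxV-attained (x ∷ c@(_ ∷ _)) with maxV-attained c | x ≤? maxV c
... | p , cp≡max | yes x≤max = suc p , trans cp≡max (sym (m≤n⇒m⊔n≡n x≤max))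
... | _ | no x≰max = zero , sym (m≥n⇒m⊔n≡m (<⇒≤ (≰⇒> x≰max)))

sum-vanishing-off-pair : ∀ (f : Fin n → ℕ) {a b} → (∀ k → k ≢ a → k ≢ b → f k ≡ 0) → sum f ≤ f a + f b
sum-vanishing-off-pair {n} f {a} {b} f≡0 with a ≟ᶠ b
... | yes refl = begin
  sum f                      ≡⟨ +-identityʳ _ ⟨
  sum f + 0                  ≤⟨ sum-mono-except f (const 0) a (λ k k≢a → ≤-reflexive (f≡0 k k≢a k≢a)) ⟩
  sum {n} (const 0) + f a    ≡⟨ cong (_+ f a) (sum-replicate-zero n) ⟩
  f a                        ≤⟨ m≤m+n _ _ ⟩
  f a + f a                  ∎
  where open ≤-Reasoning
... | no a≢b = begin
  sum f                        ≡⟨ trans (+-identityʳ _) (+-identityʳ _) ⟨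
  sum f + 0 + 0                ≤⟨ sum-mono-except₂ f (const 0) a≢b (λ k k≢a k≢b → ≤-reflexive (f≡0 k k≢a k≢b)) ⟩
  sum {n} (const 0) + f a + f b ≡⟨ cong (λ s → s + f a + f b) (sum-replicate-zero n) ⟩
  f a + f b                    ∎
  where open ≤-Reasoning

-- The paper's condition w + max m ≤ Σ m, pile by pile.
Roomy : Vec ℕ n → ℕ → Set
Roomy c w = ∀ k → lookup c k + w ≤ sum (lookup c)

ThirdPositive : Vec ℕ n → Set
ThirdPositive {n} c = ∀ (a b : Fin n) → ∃ λ r → r ≢ a × r ≢ b × 1 ≤ lookup c r

positives : Vec ℕ n → ℕ
positives c = sum (λ k → lookup c k ⊓ 1)

-- The condition s ≠ 1, for capacities that may drop to 0 in the induction.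
Enough : Vec ℕ n → ℕ → Set
Enough c w = w ≤ 1 ⊎ 3 ≤ positives c

lower : Vec ℕ n → Fin n → Vec ℕ n
lower c p = c [ p ]≔ (lookup c p ∸ 1)

3≤positives⇒ThirdPositive : 3 ≤ positives c → ThirdPositive c
3≤positives⇒ThirdPositive {c = c} 3≤pos a b
  with any? (λ r → ¬? (r ≟ᶠ a) ×-dec (¬? (r ≟ᶠ b) ×-dec (1 ≤? lookup c r)))
... | yes found = found
... | no none   = ⊥-elim (<⇒≱ 3≤pos (begin
  positives c                          ≤⟨ sum-vanishing-off-pair (λ k → lookup c k ⊓ 1) vanishing ⟩
  lookup c a ⊓ 1 + lookup c b ⊓ 1      ≤⟨ +-mono-≤ (m⊓n≤n (lookup c a) 1) (m⊓n≤n (lookup c b) 1) ⟩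
  2                                    ∎))
  where
  open ≤-Reasoning
  vanishing : ∀ k → k ≢ a → k ≢ b → lookup c k ⊓ 1 ≡ 0
  vanishing k k≢a k≢b = n≤0⇒n≡0 (≤-trans (m⊓n≤m _ 1) (≮⇒≥ (λ 0<ck → none (k , k≢a , k≢b , 0<ck))))

sum-lower : 1 ≤ lookup c p → suc (sum (lookup (lower c p))) ≡ sum (lookup c)
sum-lower {c = c} {p} 1≤cp = +-cancelʳ-≡ (lookup c p ∸ 1) _ _ (begin
  suc (sum (lookup (lower c p))) + (lookup c p ∸ 1) ≡⟨ +-suc _ _ ⟨
  sum (lookup (lower c p)) + suc (lookup c p ∸ 1)   ≡⟨ cong (sum (lookup (lower c p)) +_) (m+[n∸m]≡n 1≤cp) ⟩
  sum (lookup (lower c p)) + lookup c p             ≡⟨ sum-[]≔ id c p _ ⟩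
  sum (lookup c) + (lookup c p ∸ 1)                 ∎)
  where open ≡-Reasoning

lookup-lower≤ : ∀ (c : Vec ℕ n) p k → lookup (lower c p) k ≤ lookup c k
lookup-lower≤ c p k with k ≟ᶠ p
... | yes refl = ≤-trans (≤-reflexive (lookup∘update k c _)) (m∸n≤m _ 1)
... | no k≢p   = ≤-reflexive (lookup∘update′ k≢p c _)

Roomy-lower : Roomy c (suc w) → 1 ≤ lookup c p → Roomy (lower c p) w
Roomy-lower {c = c} {w} {p} roomy 1≤cp k = ≤-pred (begin
  suc (lookup (lower c p) k + w) ≤⟨ s≤s (+-monoˡ-≤ w (lookup-lower≤ c p k)) ⟩
  suc (lookup c k + w)           ≡⟨ +-suc _ w ⟨
  lookup c k + suc w             ≤⟨ roomy k ⟩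
  sum (lookup c)                 ≡⟨ sum-lower {c = c} {p} 1≤cp ⟨
  suc (sum (lookup (lower c p))) ∎)
  where open ≤-Reasoning

positives-lower : ∀ (c : Vec ℕ n) p →
  positives (lower c p) + lookup c p ⊓ 1 ≡ positives c + (lookup c p ∸ 1) ⊓ 1
positives-lower c p = sum-[]≔ (_⊓ 1) c p _

positive-sum⇒positive-count : ∀ (f : Fin n → ℕ) → 1 ≤ sum f → 1 ≤ sum (λ k → f k ⊓ 1)
positive-sum⇒positive-count {suc n} f 1≤sum with f zero
... | zero  = positive-sum⇒positive-count (f ∘ suc) 1≤sum
... | suc _ = s≤s z≤n

occupied+spare≤positive : ∀ h c → h ≤ c → (1 ≤ h → c ≤ 1) → h + (c ∸ h) ⊓ 1 ≤ c ⊓ 1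
occupied+spare≤positive zero          c             _        _    = ≤-refl
occupied+spare≤positive (suc zero)    (suc zero)    _        _    = ≤-refl
occupied+spare≤positive (suc (suc _)) (suc zero)    (s≤s ()) _
occupied+spare≤positive (suc _)       (suc (suc _)) _        c≤1 with c≤1 (s≤s z≤n)
... | s≤s ()

maxV-bound⇒Roomy : ∀ {m : Vec ℕ n} → w + maxV m ≤ sumV m → Roomy m w
maxV-bound⇒Roomy {w = w} {m} bound k = begin
  lookup m k + w  ≤⟨ +-monoˡ-≤ w (lookup≤maxV m k) ⟩
  maxV m + w      ≡⟨ +-comm (maxV m) w ⟩
  w + maxV m      ≤⟨ bound ⟩
  sumV m          ≡⟨ sumV≡sum m ⟩
  sum (lookup m)  ∎
  where open ≤-Reasoning

positive⇒Roomy₁ : ∀ {m : Vec ℕ (suc (suc n))} → (∀ k → 1 ≤ lookup m k) → Roomy m 1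
positive⇒Roomy₁ {m = m} positive k with another (s≤s (s≤s z≤n)) k
... | j , j≢k = ≤-trans (+-monoʳ-≤ (lookup m k) (positive j)) (pair≤sum (lookup m) (≢-sym j≢k))

positives-all : ∀ {m : Vec ℕ n} → (∀ k → 1 ≤ lookup m k) → positives m ≡ n
positives-all {m = []}    _        = refl
positives-all {m = x ∷ m} positive =
  cong₂ _+_ (m≥n⇒m⊓n≡n (positive zero)) (positives-all {m = m} (positive ∘ suc))

module Moves {A : Set} where

  Piles : ℕ → Set
  Piles n = Vec (List A) n

  private variable
    i j k : Fin n
    x y : A
    rest B L : List A
    P Q R : Piles n

  height : Piles n → Fin n → ℕ
  height P k = length (lookup P k)

  cards : Piles n → List A
  cards P = concat (toList P)

  Fits : Vec ℕ n → Piles n → Set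
  Fits c P = ∀ k → height P k ≤ lookup c k

  HasRoom : Vec ℕ n → Piles n → Fin n → Set
  HasRoom c P j = suc (height P j) ≤ lookup c j

  hasRoom? : ∀ (c : Vec ℕ n) P j → Dec (HasRoom c P j)
  hasRoom? c P j = suc (height P j) ≤? lookup c j

  move : Piles n → Fin n → Fin n → A → List A → Piles n
  move P i j x rest = (P [ i ]≔ rest) [ j ]≔ (x ∷ lookup P j)

  data Step (c : Vec ℕ n) (P : Piles n) : Piles n → Set where
    step : i ≢ j → lookup P i ≡ x ∷ rest → HasRoom c P j → Step c P (move P i j x rest)

  Steps : Vec ℕ n → Piles n → Piles n → Set
  Steps c = Star (Step c)

  move-steps : i ≢ j → lookup P i ≡ x ∷ rest → HasRoom c P j → Steps c P (move P i j x rest)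
  move-steps i≢j Pi≡ room = step i≢j Pi≡ room ◅ ε

  lookup-move-source : ∀ (P : Piles n) → i ≢ j → lookup (move P i j x rest) i ≡ rest
  lookup-move-source {i = i} {j} {x} {rest} P i≢j =
    trans (lookup∘update′ i≢j (P [ i ]≔ rest) (x ∷ lookup P j)) (lookup∘update i P rest)

  lookup-move-target : ∀ (P : Piles n) → lookup (move P i j x rest) j ≡ x ∷ lookup P j
  lookup-move-target {i = i} {j} {x} {rest} P = lookup∘update j (P [ i ]≔ rest) (x ∷ lookup P j)

  lookup-move-other : ∀ (P : Piles n) → k ≢ i → k ≢ j → lookup (move P i j x rest) k ≡ lookup P k
  lookup-move-other {i = i} {j} {x = x} {rest} P k≢i k≢j =
    trans (lookup∘update′ k≢j (P [ i ]≔ rest) (x ∷ lookup P j)) (lookup∘update′ k≢i P rest)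

  length-cards : ∀ (P : Piles n) → length (cards P) ≡ sum (height P)
  length-cards []      = refl
  length-cards (L ∷ P) = trans (length-++ L) (cong (length L +_) (length-cards P))

  cards-[]≔ : ∀ (P : Piles n) i L → cards (P [ i ]≔ L) ↭ L ++ cards (P [ i ]≔ [])
  cards-[]≔ (M ∷ P) zero    L = ↭-refl
  cards-[]≔ (M ∷ P) (suc i) L = ↭-trans (++⁺ˡ M (cards-[]≔ P i L)) (shifts M L)

  cards-split : ∀ (P : Piles n) i → cards P ↭ lookup P i ++ cards (P [ i ]≔ [])
  cards-split P i = ↭-trans (↭-reflexive (cong cards (sym ([]≔-lookup P i)))) (cards-[]≔ P i (lookup P i))

  cards-move : ∀ (P : Piles n) → i ≢ j → lookup P i ≡ x ∷ rest → cards (move P i j x rest) ↭ cards P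
  cards-move {i = i} {j} {x} {rest} P i≢j Pi≡ = begin
    cards (move P i j x rest)                              ↭⟨ cards-[]≔ (P [ i ]≔ rest) j _ ⟩
    x ∷ lookup P j ++ cards ((P [ i ]≔ rest) [ j ]≔ [])
      ≡⟨ cong (λ V → x ∷ lookup P j ++ cards V) ([]≔-commutes P i j i≢j) ⟩
    x ∷ lookup P j ++ cards (P′ [ i ]≔ rest)               ↭⟨ prep x (++⁺ˡ (lookup P j) (cards-[]≔ P′ i rest)) ⟩
    x ∷ lookup P j ++ rest ++ cards (P′ [ i ]≔ [])         ↭⟨ shift x (lookup P j) _ ⟨
    lookup P j ++ (x ∷ rest) ++ cards (P′ [ i ]≔ [])
      ≡⟨ cong (λ L → lookup P j ++ L ++ cards (P′ [ i ]≔ [])) P′i≡ ⟨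
    lookup P j ++ lookup P′ i ++ cards (P′ [ i ]≔ [])      ↭⟨ ++⁺ˡ (lookup P j) (cards-split P′ i) ⟨
    lookup P j ++ cards P′                                 ↭⟨ cards-split P j ⟨
    cards P                                                ∎
    where
    open PermutationReasoning
    P′ = P [ j ]≔ []
    P′i≡ : lookup P′ i ≡ x ∷ rest
    P′i≡ = trans (lookup∘update′ i≢j P []) Pi≡

  Step⇒↭ : Step c P Q → cards Q ↭ cards P
  Step⇒↭ {P = P} (step i≢j Pi≡ _) = cards-move P i≢j Pi≡

  Step-Fits : Step c P Q → Fits c P → Fits c Q
  Step-Fits {c = c} {P = P} (step {i = i} {j} {x} {rest} i≢j Pi≡ room) fits k with k ≟ᶠ j | k ≟ᶠ i
  ... | yes refl | _        = subst (_≤ lookup c k) (cong length (sym (lookup-move-target P))) room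
  ... | no _     | yes refl = subst (_≤ lookup c k) (cong length (sym (lookup-move-source P i≢j)))
                                (≤-trans (n≤1+n _) (subst (_≤ lookup c k) (cong length Pi≡) (fits k)))
  ... | no k≢j   | no k≢i   = subst (_≤ lookup c k) (cong length (sym (lookup-move-other P k≢i k≢j))) (fits k)

  Steps⇒↭ : Steps c P Q → cards Q ↭ cards P
  Steps⇒↭ ε         = ↭-refl
  Steps⇒↭ (s ◅ ss) = ↭-trans (Steps⇒↭ ss) (Step⇒↭ s)

  Steps-Fits : Steps c P Q → Fits c P → Fits c Q
  Steps-Fits ε         fits = fits
  Steps-Fits (s ◅ ss) fits = Steps-Fits ss (Step-Fits s fits)

  record Valid (c : Vec ℕ n) (w : ℕ) (P : Piles n) : Set where
    constructor mkValid
    field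
      fits : Fits c P
      size : length (cards P) ≡ w

  Steps-Valid : Steps c P Q → Valid c w P → Valid c w Q
  Steps-Valid ss (mkValid fits size) = mkValid (Steps-Fits ss fits) (trans (↭-length (Steps⇒↭ ss)) size)

  sum-height : Valid c w P → sum (height P) ≡ w
  sum-height {P = P} (mkValid _ size) = trans (sym (length-cards P)) size

  FullExcept : Vec ℕ n → Fin n → Fin n → Piles n → Set
  FullExcept c p q P = ∀ r → r ≢ p → r ≢ q → lookup c r ≤ height P r

  room-elsewhere : Valid c w P → Roomy c w → ∀ p → 1 ≤ height P p → ∃ λ j → j ≢ p × HasRoom c P j
  room-elsewhere {c = c} {w} {P} valid roomy p nonempty
    with any? (λ j → ¬? (j ≟ᶠ p) ×-dec hasRoom? c P j)
  ... | yes found = found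
  ... | no none   = ⊥-elim (<-irrefl refl (begin-strict
    lookup c p + w                  <⟨ m<m+n _ nonempty ⟩
    lookup c p + w + height P p     ≤⟨ +-monoˡ-≤ (height P p) (roomy p) ⟩
    sum (lookup c) + height P p     ≤⟨ sum-mono-except (lookup c) (height P) p full ⟩
    sum (height P) + lookup c p     ≡⟨ cong (_+ lookup c p) (sum-height valid) ⟩
    w + lookup c p                  ≡⟨ +-comm w _ ⟩
    lookup c p + w                  ∎))
    where
    open ≤-Reasoning
    full : ∀ k → k ≢ p → lookup c k ≤ height P k
    full k k≢p = ≮⇒≥ (λ room → none (k , k≢p , room))

  nonempty-pile : ∀ (P : Piles n) p → lookup P p ≡ x ∷ L → 1 ≤ height P p
  nonempty-pile P p Pp≡ = subst (λ L → 1 ≤ length L) (sym Pp≡) (s≤s z≤n)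

  clear-pile : Roomy c w → ∀ p → Valid c w P → ∃ λ P′ → Steps c P P′ × lookup P′ p ≡ []
  clear-pile {c = c} {w} {P} roomy p = go (lookup P p) P refl
    where
    go : ∀ L P → lookup P p ≡ L → Valid c w P → ∃ λ P′ → Steps c P P′ × lookup P′ p ≡ []
    go []         P Pp≡ _     = P , ε , Pp≡
    go (x ∷ rest) P Pp≡ valid with room-elsewhere valid roomy p (nonempty-pile P p Pp≡)
    ... | j , j≢p , room =
      let moved = move-steps (j≢p ∘ sym) Pp≡ room
          P′ , ss , P′p≡ = go rest _ (lookup-move-source P (j≢p ∘ sym)) (Steps-Valid moved valid)
      in P′ , moved ◅◅ ss , P′p≡

  transfer : ∀ {p q} → p ≢ q → height P p + height P q ≤ lookup c q →
    ∃ λ P′ → Steps c P P′ × lookup P′ p ≡ [] × (∀ r → r ≢ p → r ≢ q → lookup P′ r ≡ lookup P r)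
  transfer {P = P} {c} {p} {q} p≢q fits = go (lookup P p) P refl fits
    where
    go : ∀ L P → lookup P p ≡ L → height P p + height P q ≤ lookup c q →
      ∃ λ P′ → Steps c P P′ × lookup P′ p ≡ [] × (∀ r → r ≢ p → r ≢ q → lookup P′ r ≡ lookup P r)
    go []         P Pp≡ _    = P , ε , Pp≡ , λ _ _ _ → refl
    go (x ∷ rest) P Pp≡ fits =
      let moved = move-steps p≢q Pp≡ (≤-trans (+-monoˡ-≤ (height P q) (nonempty-pile P p Pp≡)) fits)
          fits′ = subst₂ (λ a b → a + b ≤ lookup c q)
                    (cong length (sym (lookup-move-source P p≢q)))
                    (cong length (sym (lookup-move-target P)))
                    (subst (_≤ lookup c q) (trans (cong (λ L → length L + height P q) Pp≡) (sym (+-suc _ _))) fits)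
          P′ , ss , P′p≡ , others = go rest _ (lookup-move-source P p≢q) fits′
      in P′ , moved ◅◅ ss , P′p≡ , λ r r≢p r≢q → trans (others r r≢p r≢q) (lookup-move-other P r≢p r≢q)

  -- The invariant while the cards above x are moved off pile q, x being bound for pile p.
  ClearOrJammed : Vec ℕ n → Fin n → Fin n → Piles n → Set
  ClearOrJammed c p q P = lookup P p ≡ [] ⊎ (1 ≤ height P p × FullExcept c p q P)

  uncover : Roomy c w → p ≢ q → ∀ D → Valid c w P → lookup P q ≡ D ++ x ∷ B → ClearOrJammed c p q P →
    ∃ λ P′ → Steps c P P′ × Valid c w P′ × lookup P′ q ≡ x ∷ B × ClearOrJammed c p q P′
  uncover {P = P} roomy p≢q [] valid Pq≡ state = P , ε , valid , Pq≡ , state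
  uncover {c = c} {w} {p} {q} {P} {x} {B} roomy p≢q (y ∷ D) valid Pq≡ state
    with any? (λ r → ¬? (r ≟ᶠ p) ×-dec (¬? (r ≟ᶠ q) ×-dec hasRoom? c P r))
  ... | yes (r , r≢p , r≢q , room) =
    let moved = move-steps (r≢q ∘ sym) Pq≡ room
        P′ , ss , valid′ , P′q≡ , state′ = uncover roomy p≢q D (Steps-Valid moved valid)
          (lookup-move-source P (r≢q ∘ sym)) (still-clear state)
    in P′ , moved ◅◅ ss , valid′ , P′q≡ , state′
    where
    still-clear : ClearOrJammed c p q P → ClearOrJammed c p q (move P q r y (D ++ x ∷ B))
    still-clear (inj₁ Pp≡[])    = inj₁ (trans (lookup-move-other P p≢q (r≢p ∘ sym)) Pp≡[])
    still-clear (inj₂ (_ , full)) = ⊥-elim (<⇒≱ room (full r r≢p r≢q))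
  ... | no none with room-elsewhere valid roomy q (nonempty-pile P q Pq≡)
  ... | j , j≢q , room with j ≟ᶠ p
  ... | no j≢p    = ⊥-elim (none (j , j≢p , j≢q , room))
  ... | yes refl =
    let moved = move-steps (j≢q ∘ sym) Pq≡ room
        jammed = inj₂ (nonempty-pile (move P q j y (D ++ x ∷ B)) j (lookup-move-target P) ,
                       λ r r≢j r≢q → subst (lookup c r ≤_)
                         (cong length (sym (lookup-move-other P r≢q r≢j)))
                         (≮⇒≥ (λ room → none (r , r≢j , r≢q , room))))
        P′ , ss , valid′ , P′q≡ , state′ = uncover roomy p≢q D (Steps-Valid moved valid)
          (lookup-move-source P (j≢q ∘ sym)) jammed
    in P′ , moved ◅◅ ss , valid′ , P′q≡ , state′

  jammed-transfer-fits : Valid c w P → Roomy c w → p ≢ q → FullExcept c p q P →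
    height P p + height P q ≤ lookup c q
  jammed-transfer-fits {c = c} {w} {P} {p} {q} valid roomy p≢q full =
    +-cancelˡ-≤ (lookup c p + w) _ _ (begin
      lookup c p + w + (height P p + height P q)  ≤⟨ +-monoˡ-≤ _ (roomy p) ⟩
      sum (lookup c) + (height P p + height P q)  ≡⟨ +-assoc (sum (lookup c)) _ _ ⟨
      sum (lookup c) + height P p + height P q    ≤⟨ sum-mono-except₂ (lookup c) (height P) p≢q full ⟩
      sum (height P) + lookup c p + lookup c q    ≡⟨ cong (λ s → s + lookup c p + lookup c q) (sum-height valid) ⟩
      w + lookup c p + lookup c q                 ≡⟨ cong (_+ lookup c q) (+-comm w (lookup c p)) ⟩
      lookup c p + w + lookup c q                 ∎)
    where open ≤-Reasoning

  -- Move the top card of a third pile r onto p, park x on r, pour p onto q (it fits, as all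
  -- other piles are full), and drop x onto the emptied p.
  settle-jammed : Roomy c w → ThirdPositive c → p ≢ q → 1 ≤ lookup c p → Valid c w P →
    lookup P q ≡ x ∷ B → FullExcept c p q P → ∃ λ P′ → Steps c P P′ × lookup P′ p ≡ [ x ]
  settle-jammed {c = c} {w} {p} {q} {P} {x} {B} roomy third p≢q 1≤cp valid Pq≡ full
    with third p q
  ... | r , r≢p , r≢q , 1≤cr with lookup P r in Pr≡
  ... | [] = ⊥-elim (<⇒≱ 1≤cr (subst (lookup c r ≤_) (cong length Pr≡) (full r r≢p r≢q)))
  ... | z ∷ R with room-elsewhere valid roomy q (nonempty-pile P q Pq≡)
  ... | j , j≢q , room with j ≟ᶠ p
  ... | no j≢p   = ⊥-elim (<⇒≱ room (full j j≢p j≢q))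
  ... | yes refl =
    let P₁ = move P r p z R
        s₁ = move-steps r≢p Pr≡ room
        P₁q≡ = trans (lookup-move-other P q≢r q≢p) Pq≡
        room₁ = subst (λ L → suc (length L) ≤ lookup c r) (sym (lookup-move-source P r≢p))
                  (subst (_≤ lookup c r) (cong length Pr≡) (Valid.fits valid r))
        P₂ = move P₁ q r x B
        s₂ = move-steps q≢r P₁q≡ room₁
        P₂r≡ = trans (lookup-move-target P₁) (cong (x ∷_) (lookup-move-source P r≢p))
        P₃ , s₃ , P₃p≡ , P₃-others = transfer p≢q
          (jammed-transfer-fits (Steps-Valid (s₁ ◅◅ s₂) valid) roomy p≢q (full₂ P₂r≡))
        s₄ = move-steps r≢p (trans (P₃-others r r≢p r≢q) P₂r≡)
               (subst (λ L → suc (length L) ≤ lookup c p) (sym P₃p≡) 1≤cp)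
    in _ , s₁ ◅◅ s₂ ◅◅ s₃ ◅◅ s₄ , trans (lookup-move-target P₃) (cong (x ∷_) P₃p≡)
    where
    q≢p : q ≢ p
    q≢p = p≢q ∘ sym
    q≢r : q ≢ r
    q≢r = r≢q ∘ sym
    full₂ : lookup (move (move P r p z R) q r x B) r ≡ x ∷ R → FullExcept c p q (move (move P r p z R) q r x B)
    full₂ P₂r≡ k k≢p k≢q with k ≟ᶠ r
    ... | yes refl = subst (lookup c k ≤_) (trans (cong length Pr≡) (sym (cong length P₂r≡))) (full k k≢p k≢q)
    ... | no k≢r   = subst (lookup c k ≤_)
                       (cong length (sym (trans (lookup-move-other (move P r p z R) k≢q k≢r)
                                                (lookup-move-other P k≢r k≢p))))
                       (full k k≢p k≢q)

  settle : Roomy c w → (w ≤ 1 ⊎ ThirdPositive c) → p ≢ q → 1 ≤ lookup c p → Valid c w P →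
    lookup P q ≡ x ∷ B → ClearOrJammed c p q P → ∃ λ P′ → Steps c P P′ × lookup P′ p ≡ [ x ]
  settle {c = c} {P = P} {x} _ _ p≢q 1≤cp _ Pq≡ (inj₁ Pp≡[]) =
    _ , move-steps (p≢q ∘ sym) Pq≡ (subst (λ L → suc (length L) ≤ lookup c _) (sym Pp≡[]) 1≤cp) ,
    trans (lookup-move-target P) (cong (x ∷_) Pp≡[])
  settle {p = p} {q = q} {P = P} _ (inj₁ w≤1) p≢q _ valid Pq≡ (inj₂ (1≤hp , _)) =
    ⊥-elim (<⇒≱ (≤-trans (+-mono-≤ 1≤hp (nonempty-pile P q Pq≡)) (pair≤sum (height P) p≢q))
                (≤-trans (≤-reflexive (sum-height valid)) w≤1))
  settle roomy (inj₂ third) p≢q 1≤cp valid Pq≡ (inj₂ (_ , full)) =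
    settle-jammed roomy third p≢q 1≤cp valid Pq≡ full

  ∈-cards : ∀ (P : Piles n) → x ∈ cards P → ∃ λ q → x ∈ lookup P q
  ∈-cards (L ∷ P) x∈ with ∈-++⁻ L x∈
  ... | inj₁ x∈L = zero , x∈L
  ... | inj₂ x∈P = Data.Product.map suc id (∈-cards P x∈P)

  isolate : Roomy c w → (w ≤ 1 ⊎ ThirdPositive c) → ∀ p → 1 ≤ lookup c p → Valid c w P →
    x ∈ cards P → ∃ λ P′ → Steps c P P′ × lookup P′ p ≡ [ x ]
  isolate {P = P} roomy enough p 1≤cp valid x∈P
    with clear-pile roomy p valid
  ... | P₀ , s₀ , P₀p≡[] with ∈-cards P₀ (∈-resp-↭ (↭-sym (Steps⇒↭ s₀)) x∈P)
  ... | q , x∈P₀q with q ≟ᶠ p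
  ... | yes refl = case subst (_ ∈_) P₀p≡[] x∈P₀q of λ ()
  ... | no q≢p with ∈-∃++ x∈P₀q
  ... | D , B , P₀q≡ =
    let valid₀ = Steps-Valid s₀ valid
        P₁ , s₁ , valid₁ , P₁q≡ , state₁ = uncover roomy (q≢p ∘ sym) D valid₀ P₀q≡ (inj₁ P₀p≡[])
        P₂ , s₂ , P₂p≡ = settle roomy enough (q≢p ∘ sym) 1≤cp valid₁ P₁q≡ state₁
    in P₂ , s₀ ◅◅ s₁ ◅◅ s₂ , P₂p≡

  lookup-ext : ∀ {P Q : Piles n} → (∀ k → lookup P k ≡ lookup Q k) → P ≡ Q
  lookup-ext {P = P} {Q} eq = trans (sym (tabulate∘lookup P)) (trans (tabulate-cong eq) (tabulate∘lookup Q))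

  under : Fin n → A → Fin n → List A → List A
  under p x k L with k ≟ᶠ p
  ... | yes _ = L ++ [ x ]
  ... | no _  = L

  under-∷ : ∀ (p : Fin n) x k y L → under p x k (y ∷ L) ≡ y ∷ under p x k L
  under-∷ p x k y L with k ≟ᶠ p
  ... | yes _ = refl
  ... | no _  = refl

  putUnder : Fin n → A → Piles n → Piles n
  putUnder p x P = P [ p ]≔ (lookup P p ++ [ x ])

  lookup-putUnder : ∀ p x (P : Piles n) k → lookup (putUnder p x P) k ≡ under p x k (lookup P k)
  lookup-putUnder p x P k with k ≟ᶠ p
  ... | yes refl = lookup∘update k P _
  ... | no k≢p   = lookup∘update′ k≢p P _

  HasRoom-putUnder : 1 ≤ lookup c p → HasRoom (lower c p) P j → HasRoom c (putUnder p x P) j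
  HasRoom-putUnder {c = c} {p} {P} {j} {x} 1≤cp room with j ≟ᶠ p
  ... | yes refl = begin
    suc (height (putUnder j x P) j)       ≡⟨ cong (suc ∘ length) (lookup∘update j P _) ⟩
    suc (length (lookup P j ++ [ x ]))    ≡⟨ cong suc (trans (length-++ (lookup P j)) (+-comm _ 1)) ⟩
    1 + suc (height P j)                  ≤⟨ +-monoʳ-≤ 1 (subst (suc (height P j) ≤_) (lookup∘update j c _) room) ⟩
    1 + (lookup c j ∸ 1)                  ≡⟨ m+[n∸m]≡n 1≤cp ⟩
    lookup c j                            ∎
    where open ≤-Reasoning
  ... | no j≢p = subst₂ (λ L m → suc (length L) ≤ m)
                   (sym (lookup∘update′ j≢p P _)) (lookup∘update′ j≢p c _) room

  move-putUnder : ∀ (P : Piles n) → i ≢ j →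
    move (putUnder p x P) i j y (under p x i rest) ≡ putUnder p x (move P i j y rest)
  move-putUnder {i = i} {j} {p} {x} {y} {rest} P i≢j = lookup-ext pointwise
    where
    pointwise : ∀ k → lookup (move (putUnder p x P) i j y (under p x i rest)) k
                    ≡ lookup (putUnder p x (move P i j y rest)) k
    pointwise k with k ≟ᶠ j | k ≟ᶠ i
    ... | yes refl | _ = begin
      lookup (move (putUnder p x P) i k y (under p x i rest)) k ≡⟨ lookup-move-target (putUnder p x P) ⟩
      y ∷ lookup (putUnder p x P) k       ≡⟨ cong (y ∷_) (lookup-putUnder p x P k) ⟩
      y ∷ under p x k (lookup P k)        ≡⟨ under-∷ p x k y _ ⟨
      under p x k (y ∷ lookup P k)        ≡⟨ cong (under p x k) (lookup-move-target P) ⟨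
      under p x k (lookup (move P i k y rest) k) ≡⟨ lookup-putUnder p x (move P i k y rest) k ⟨
      lookup (putUnder p x (move P i k y rest)) k ∎
      where open ≡-Reasoning
    ... | no _ | yes refl = trans (lookup-move-source (putUnder p x P) i≢j)
      (sym (trans (lookup-putUnder p x (move P i j y rest) k) (cong (under p x k) (lookup-move-source P i≢j))))
    ... | no k≢j | no k≢i = trans (lookup-move-other (putUnder p x P) k≢i k≢j)
      (trans (lookup-putUnder p x P k)
        (sym (trans (lookup-putUnder p x (move P i j y rest) k) (cong (under p x k) (lookup-move-other P k≢i k≢j)))))

  Step-putUnder : 1 ≤ lookup c p → Step (lower c p) P Q → Step c (putUnder p x P) (putUnder p x Q)
  Step-putUnder {c = c} {p} {P} {x = x} 1≤cp (step {i = i} {j} {y} {rest} i≢j Pi≡ room) =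
    subst (Step c (putUnder p x P)) (move-putUnder P i≢j)
      (step i≢j (trans (lookup-putUnder p x P i) (trans (cong (under p x i) Pi≡) (under-∷ p x i y rest)))
            (HasRoom-putUnder {c = c} {p} {P} {j} 1≤cp room))

  Steps-putUnder : 1 ≤ lookup c p → Steps (lower c p) P Q → Steps c (putUnder p x P) (putUnder p x Q)
  Steps-putUnder 1≤cp ε        = ε
  Steps-putUnder 1≤cp (s ◅ ss) = Step-putUnder 1≤cp s ◅ Steps-putUnder 1≤cp ss

  putUnder-peel : ∀ (P : Piles n) → lookup P p ≡ L ++ [ x ] → putUnder p x (P [ p ]≔ L) ≡ P
  putUnder-peel {p = p} {L} {x} P Pp≡ = begin
    (P [ p ]≔ L) [ p ]≔ (lookup (P [ p ]≔ L) p ++ [ x ])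
      ≡⟨ cong (λ M → (P [ p ]≔ L) [ p ]≔ (M ++ [ x ])) (lookup∘update p P L) ⟩
    (P [ p ]≔ L) [ p ]≔ (L ++ [ x ])                     ≡⟨ []≔-idempotent P p ⟩
    P [ p ]≔ (L ++ [ x ])                                ≡⟨ cong (P [ p ]≔_) Pp≡ ⟨
    P [ p ]≔ lookup P p                                  ≡⟨ []≔-lookup P p ⟩
    P                                                    ∎
    where open ≡-Reasoning

  cards-peel : ∀ (P : Piles n) → lookup P p ≡ L ++ [ x ] → cards P ↭ x ∷ cards (P [ p ]≔ L)
  cards-peel {p = p} {L} {x} P Pp≡ = begin
    cards P                                 ↭⟨ cards-split P p ⟩
    lookup P p ++ cards (P [ p ]≔ [])       ≡⟨ cong (_++ cards (P [ p ]≔ [])) Pp≡ ⟩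
    (L ++ [ x ]) ++ cards (P [ p ]≔ [])     ≡⟨ ++-assoc L [ x ] _ ⟩
    L ++ [ x ] ++ cards (P [ p ]≔ [])       ↭⟨ shift x L _ ⟩
    x ∷ L ++ cards (P [ p ]≔ [])            ↭⟨ prep x (cards-[]≔ P p L) ⟨
    x ∷ cards (P [ p ]≔ L)                  ∎
    where open PermutationReasoning

  Fits-peel : ∀ (P : Piles n) → Fits c P → lookup P p ≡ L ++ [ x ] → Fits (lower c p) (P [ p ]≔ L)
  Fits-peel {c = c} {p} {L} P fits Pp≡ k with k ≟ᶠ p
  ... | yes refl = subst₂ _≤_ (cong length (sym (lookup∘update k P L))) (sym (lookup∘update k c _))
                     (m+n≤o⇒m≤o∸n (length L) (subst (_≤ lookup c k) (trans (cong length Pp≡) (length-++ L)) (fits k)))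
  ... | no k≢p   = subst₂ _≤_ (cong length (sym (lookup∘update′ k≢p P L))) (sym (lookup∘update′ k≢p c _)) (fits k)

  Valid-peel : ∀ {P : Piles n} → Valid c (suc w) P → lookup P p ≡ L ++ [ x ] → Valid (lower c p) w (P [ p ]≔ L)
  Valid-peel {c = c} {P = P} (mkValid fits size) Pp≡ =
    mkValid (Fits-peel {c = c} P fits Pp≡) (suc-injective (trans (sym (↭-length (cards-peel P Pp≡))) size))

  unsnoc : ∀ (L : List A) → 1 ≤ length L → ∃₂ λ I x → L ≡ I ++ [ x ]
  unsnoc L 1≤len with initLast L
  ... | I ∷ʳ′ x = I , x , refl

  Valid-empty : Valid c 0 P → ∀ k → lookup P k ≡ []
  Valid-empty {P = P} valid k with lookup P k | subst (height P k ≤_) (sum-height valid) (point≤sum (height P) k)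
  ... | []    | _  = refl
  ... | _ ∷ _ | ()

  nonempty-exists : Valid c (suc w) P → ∃ λ p → 1 ≤ height P p
  nonempty-exists {n} {P = P} valid with any? (λ p → 1 ≤? height P p)
  ... | yes found = found
  ... | no none   = case subst (_≤ 0) (sum-height valid) all-empty of λ ()
    where
    all-empty : sum (height P) ≤ 0
    all-empty = ≤-trans (sum-mono-≤ (λ k → ≮⇒≥ (λ 0<h → none (k , 0<h)))) (≤-reflexive (sum-replicate-zero n))

  sparse⇒many-positives : Valid c w P → Roomy c w → 1 ≤ height P p →
    (∀ k → 1 ≤ height P k → lookup c k ≤ 1) → suc w ≤ positives c
  sparse⇒many-positives {c = c} {w} {P} {p} valid roomy 1≤hp sparse = begin
    suc w                                   ≡⟨ +-comm 1 w ⟩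
    w + 1                                   ≤⟨ +-monoʳ-≤ w (positive-sum⇒positive-count spare some-spare) ⟩
    w + sum (λ k → spare k ⊓ 1)             ≡⟨ cong (_+ sum (λ k → spare k ⊓ 1)) (sum-height valid) ⟨
    sum (height P) + sum (λ k → spare k ⊓ 1) ≡⟨ ∑-distrib-+ (height P) _ ⟨
    sum (λ k → height P k + spare k ⊓ 1)
      ≤⟨ sum-mono-≤ (λ k → occupied+spare≤positive _ _ (Valid.fits valid k) (sparse k)) ⟩
    positives c                             ∎
    where
    open ≤-Reasoning
    spare : Fin _ → ℕ
    spare k = lookup c k ∸ height P k
    sum-spare : sum spare + w ≡ sum (lookup c)
    sum-spare = begin-equality
      sum spare + w                          ≡⟨ cong (sum spare +_) (sum-height valid) ⟨
      sum spare + sum (height P)             ≡⟨ ∑-distrib-+ spare (height P) ⟨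
      sum (λ k → spare k + height P k)       ≡⟨ sum-cong-≗ (λ k → m∸n+n≡m (Valid.fits valid k)) ⟩
      sum (lookup c)                         ∎
    some-spare : 1 ≤ sum spare
    some-spare = ≤-trans (≤-trans 1≤hp (Valid.fits valid p))
                   (+-cancelʳ-≤ w _ _ (subst (lookup c p + w ≤_) (sym sum-spare) (roomy p)))

  choose-pile : Valid c (suc w) P → Roomy c (suc w) → Enough c (suc w) →
    ∃ λ p → 1 ≤ height P p × Enough (lower c p) w
  choose-pile {c = c} {w} {P} valid roomy enough with w ≤? 1
  ... | yes w≤1 = let p , 1≤hp = nonempty-exists valid in p , 1≤hp , inj₁ w≤1
  ... | no w≰1 with enough
  ... | inj₁ 1+w≤1 = contradiction (≤-trans (n≤1+n w) 1+w≤1) w≰1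
  ... | inj₂ 3≤pos with any? (λ p → (1 ≤? height P p) ×-dec (2 ≤? lookup c p))
  ... | yes (p , 1≤hp , 2≤cp) = p , 1≤hp , inj₂ (subst (3 ≤_) (+-cancelʳ-≡ 1 _ _ (begin-equality
    positives c + 1                          ≡⟨ cong (positives c +_) (m≥n⇒m⊓n≡n (m+n≤o⇒m≤o∸n 1 2≤cp)) ⟨
    positives c + (lookup c p ∸ 1) ⊓ 1       ≡⟨ positives-lower c p ⟨
    positives (lower c p) + lookup c p ⊓ 1   ≡⟨ cong (positives (lower c p) +_) (m≥n⇒m⊓n≡n (≤-trans (s≤s z≤n) 2≤cp)) ⟩
    positives (lower c p) + 1                ∎)) 3≤pos)
    where open ≤-Reasoning
  ... | no none with nonempty-exists valid
  ... | p , 1≤hp = p , 1≤hp , inj₂ (+-cancelʳ-≤ 1 3 _ (begin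
    4                                        ≤⟨ s≤s (s≤s (≰⇒> w≰1)) ⟩
    suc (suc w)                              ≤⟨ sparse⇒many-positives valid roomy 1≤hp sparse ⟩
    positives c                              ≡⟨ +-identityʳ _ ⟨
    positives c + 0                          ≡⟨ cong (λ m → positives c + (m ∸ 1) ⊓ 1) cp≡1 ⟨
    positives c + (lookup c p ∸ 1) ⊓ 1        ≡⟨ positives-lower c p ⟨
    positives (lower c p) + lookup c p ⊓ 1   ≡⟨ cong (λ m → positives (lower c p) + m ⊓ 1) cp≡1 ⟩
    positives (lower c p) + 1                ∎))
    where
    open ≤-Reasoning
    sparse : ∀ k → 1 ≤ height P k → lookup c k ≤ 1
    sparse k 1≤hk = ≤-pred (≰⇒> (λ 2≤ck → none (k , 1≤hk , 2≤ck)))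
    cp≡1 : lookup c p ≡ 1
    cp≡1 = ≤-antisym (sparse p 1≤hp) (≤-trans 1≤hp (Valid.fits valid p))

  solve : ∀ w (c : Vec ℕ n) {P Q} → Valid c w P → Valid c w Q → cards P ↭ cards Q →
    Roomy c w → Enough c w → Steps c P Q
  solve zero c {P} P-valid Q-valid _ _ _ =
    subst (Steps c P) (lookup-ext λ k → trans (Valid-empty P-valid k) (sym (Valid-empty Q-valid k))) ε
  solve (suc w) c {P} {Q} P-valid Q-valid P↭Q roomy enough with choose-pile Q-valid roomy enough
  ... | p , 1≤hQp , enough′ with unsnoc (lookup Q p) 1≤hQp
  ... | I , x , Qp≡ =
    let 1≤cp             = ≤-trans 1≤hQp (Valid.fits Q-valid p)
        x∈P              = ∈-resp-↭ (↭-sym (↭-trans P↭Q (cards-peel Q Qp≡))) (here refl)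
        P′ , P⇝P′ , P′p≡ = isolate {c = c} roomy (map₂ (3≤positives⇒ThirdPositive {c = c}) enough) p 1≤cp P-valid x∈P
        rest↭            = drop-∷ (↭-trans (↭-sym (cards-peel {L = []} P′ P′p≡))
                                   (↭-trans (Steps⇒↭ P⇝P′) (↭-trans P↭Q (cards-peel Q Qp≡))))
        inner            = solve w (lower c p)
                             (Valid-peel {L = []} (Steps-Valid P⇝P′ P-valid) P′p≡) (Valid-peel Q-valid Qp≡) rest↭
                             (Roomy-lower {c = c} roomy 1≤cp) enough′
    in P⇝P′ ◅◅ subst₂ (Steps c) (putUnder-peel {L = []} P′ P′p≡) (putUnder-peel Q Qp≡) (Steps-putUnder 1≤cp inner)

map-fixes-∈ : ∀ {B : Set} (f : B → B) {L x} → map f L ≡ L → x ∈ L → f x ≡ x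
map-fixes-∈ f {y ∷ L} fL≡L (here refl) = proj₁ (∷-injective fL≡L)
map-fixes-∈ f {y ∷ L} fL≡L (there x∈L) = map-fixes-∈ f (proj₂ (∷-injective fL≡L)) x∈L

map-allFin-↭ : ∀ (π : Permutation′ n) → map (π ⟨$⟩ʳ_) (allFin n) ↭ allFin n
map-allFin-↭ {n} π = ∼bag⇒↭ (unique∧set⇒bag (unique-map⁺ injective (allFin⁺ n)) (allFin⁺ n)
  (λ {x} → mk⇔ (λ _ → ∈-allFin x)
                (λ _ → subst (_∈ map (π ⟨$⟩ʳ_) (allFin n)) (inverseʳ π) (∈-map⁺ (π ⟨$⟩ʳ_) (∈-allFin (π ⟨$⟩ˡ x))))))
  where
  injective : ∀ {x y} → π ⟨$⟩ʳ x ≡ π ⟨$⟩ʳ y → x ≡ y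
  injective {x} {y} eq = trans (sym (inverseˡ π)) (trans (cong (π ⟨$⟩ˡ_) eq) (inverseˡ π))

transpose-source : ∀ (a b : Fin n) → transpose a b ⟨$⟩ʳ a ≡ b
transpose-source a b rewrite dec-true (a ≟ᶠ a) refl = refl


module _ {w : ℕ} where
  open Moves {Fin w}

  private variable
    m : Vec ℕ n
    f P Q R : Config w n

  IsState⇒Valid : IsState m P → Valid m w P
  IsState⇒Valid (P↭ , fits) = mkValid fits (trans (↭-length P↭) (length-tabulate id))

  Steps⇒Reachable : Steps m P Q → IsState m P → Reachable m P Q
  Steps⇒Reachable ε                              _       = ε
  Steps⇒Reachable (s@(step i≢j Pi≡ _) ◅ ss) P-state =
    (P-state , Q-state , _ , _ , i≢j , _ , _ , Pi≡ , refl) ◅ Steps⇒Reachable ss Q-state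
    where
    Q-state = ↭-trans (Step⇒↭ s) (proj₁ P-state) , Step-Fits s (proj₂ P-state)

  solvable : ∀ (m : Vec ℕ n) (f : Config w n) → Roomy m w → Enough m w → IsState m f → AlwaysSolvable m f
  solvable m f roomy enough f-state P P-state = Steps⇒Reachable
    (solve w m (IsState⇒Valid P-state) (IsState⇒Valid f-state)
       (↭-trans (proj₁ P-state) (↭-sym (proj₁ f-state))) roomy enough)
    P-state

  relabel : Permutation′ w → Config w n → Config w n
  relabel π = Vec.map (map (π ⟨$⟩ʳ_))

  relabel-IsState : ∀ π → IsState m P → IsState m (relabel π P)
  relabel-IsState {m = m} {P = P} π (P↭ , fits) =
    ↭-trans (↭-reflexive cards≡) (↭-trans (↭-map⁺ (π ⟨$⟩ʳ_) P↭) (map-allFin-↭ π)) ,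
    λ i → subst (_≤ lookup m i) (sym (trans (cong length (lookup-map i _ P)) (length-map _ (lookup P i)))) (fits i)
    where
    cards≡ : cards (relabel π P) ≡ map (π ⟨$⟩ʳ_) (cards P)
    cards≡ = trans (cong concat (toList-map _ P)) (concat-map (toList P))

  readout : Config w 2 → List (Fin w)
  readout P = reverse (lookup P zero) ++ lookup P (suc zero)

  Move-readout : ∀ {m : Vec ℕ 2} {P Q} → Move m P Q → readout Q ≡ readout P
  Move-readout (_ , _ , zero     , zero     , i≢j , _) = contradiction refl i≢j
  Move-readout (_ , _ , suc zero , suc zero , i≢j , _) = contradiction refl i≢j
  Move-readout {P = L₀ ∷ L₁ ∷ []} (_ , _ , zero , suc zero , _ , x , rest , refl , refl) =
    sym (trans (cong (_++ L₁) (unfold-reverse x rest)) (++-assoc (reverse rest) [ x ] L₁))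
  Move-readout {P = L₀ ∷ L₁ ∷ []} (_ , _ , suc zero , zero , _ , x , rest , refl , refl) =
    trans (cong (_++ rest) (unfold-reverse x L₀)) (++-assoc (reverse L₀) [ x ] rest)

  Reachable-readout : ∀ {m : Vec ℕ 2} {P Q} → Reachable m P Q → readout Q ≡ readout P
  Reachable-readout ε          = refl
  Reachable-readout {m} (mv ◅ mvs) = trans (Reachable-readout {m} mvs) (Move-readout {m} mv)

  readout-relabel : ∀ π (P : Config w 2) → readout (relabel π P) ≡ map (π ⟨$⟩ʳ_) (readout P)
  readout-relabel π (L₀ ∷ L₁ ∷ []) =
    trans (cong (_++ map _ L₁) (sym (reverse-map _ L₀))) (sym (map-++ _ (reverse L₀) L₁))

  readout↭cards : ∀ (P : Config w 2) → readout P ↭ cards P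
  readout↭cards (L₀ ∷ L₁ ∷ []) = ↭-trans (++⁺ʳ L₁ (↭-reverse L₀)) (++⁺ˡ L₀ (↭-reflexive (sym (++-identityʳ L₁))))

  two-piles-unsolvable : ∀ {m : Vec ℕ 2} {f} → 2 ≤ w → IsState m f → ¬ AlwaysSolvable m f
  two-piles-unsolvable {m = m} {f} 2≤w f-state solvable =
    proj₂ (another 2≤w a) (trans (sym (transpose-source a b)) (map-fixes-∈ (transpose a b ⟨$⟩ʳ_) fixed a∈readout))
    where
    a : Fin w
    a = fromℕ< (≤-trans (s≤s z≤n) 2≤w)
    b = proj₁ (another 2≤w a)
    π = transpose a b
    fixed : map (π ⟨$⟩ʳ_) (readout f) ≡ readout f
    fixed = sym (trans (Reachable-readout {m} {relabel π f}
                          (solvable (relabel π f) (relabel-IsState {m = m} {P = f} π f-state)))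
                        (readout-relabel π f))
    a∈readout : a ∈ readout f
    a∈readout = ∈-resp-↭ (↭-sym (↭-trans (readout↭cards f) (proj₁ f-state))) (∈-allFin a)

  pop-bottom : ∀ {x b : Fin w} {rest} L → x ∷ rest ≡ L ++ [ b ] → 1 ≤ length rest → ∃ λ L′ → rest ≡ L′ ++ [ b ]
  pop-bottom []      eq 1≤len = case subst (λ L → 1 ≤ length L) (proj₂ (∷-injective eq)) 1≤len of λ ()
  pop-bottom (_ ∷ L) eq _     = L , proj₂ (∷-injective eq)

  module Crowded (m : Vec ℕ n) (p : Fin n) (crowded : sum (lookup m) < w + lookup m p) where

    IsState⇒nonempty : IsState m P → 1 ≤ height P p
    IsState⇒nonempty {P = P} P-state = ≰⇒> λ hp≤0 → <⇒≱ crowded (begin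
      w + lookup m p                  ≡⟨ cong (_+ lookup m p) (sum-height (IsState⇒Valid {m = m} {P = P} P-state)) ⟨
      sum (height P) + lookup m p     ≤⟨ sum-mono-except (height P) (lookup m) p (λ k _ → proj₂ P-state k) ⟩
      sum (lookup m) + height P p     ≤⟨ +-monoʳ-≤ _ hp≤0 ⟩
      sum (lookup m) + 0              ≡⟨ +-identityʳ _ ⟩
      sum (lookup m)                  ∎)
      where open ≤-Reasoning

    BottomIs : Fin w → Config w n → Set
    BottomIs b P = ∃ λ L → lookup P p ≡ L ++ [ b ]

    Move-BottomIs : ∀ {b} → Move m P Q → BottomIs b P → BottomIs b Q
    Move-BottomIs {P = P} (_ , Q-state , i , j , i≢j , x , rest , Pi≡ , refl) (L , Pp≡)
      with p ≟ᶠ i | p ≟ᶠ j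
    ... | yes refl | _ = Data.Product.map id (trans (lookup-move-source P i≢j))
                           (pop-bottom L (trans (sym Pi≡) Pp≡)
                             (subst (λ L → 1 ≤ length L) (lookup-move-source P i≢j)
                                    (IsState⇒nonempty {P = move P i j x rest} Q-state)))
    ... | no _     | yes refl = x ∷ L , trans (lookup-move-target P) (cong (x ∷_) Pp≡)
    ... | no p≢i   | no p≢j   = L , trans (lookup-move-other P p≢i p≢j) Pp≡

    Reachable-BottomIs : ∀ {b} → Reachable m P Q → BottomIs b P → BottomIs b Q
    Reachable-BottomIs ε          bottom = bottom
    Reachable-BottomIs {P = P} (_◅_ {j = R} mv mvs) bottom =
      Reachable-BottomIs mvs (Move-BottomIs {P = P} {R} mv bottom)

    crowded-unsolvable : 2 ≤ w → IsState m f → ¬ AlwaysSolvable m f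
    crowded-unsolvable {f = f} 2≤w f-state solvable with unsnoc (lookup f p) (IsState⇒nonempty {P = f} f-state)
    ... | L , b , fp≡ with another 2≤w b
    ... | y , y≢b = y≢b (∷ʳ-injectiveʳ L′ L (trans (sym fp≡′) fp≡))
      where
      π = transpose b y
      relabelled-bottom : BottomIs y (relabel π f)
      relabelled-bottom = map (π ⟨$⟩ʳ_) L , (begin
        lookup (relabel π f) p             ≡⟨ lookup-map p _ f ⟩
        map (π ⟨$⟩ʳ_) (lookup f p)         ≡⟨ cong (map (π ⟨$⟩ʳ_)) fp≡ ⟩
        map (π ⟨$⟩ʳ_) (L ++ [ b ])         ≡⟨ map-++ _ L [ b ] ⟩
        map (π ⟨$⟩ʳ_) L ++ [ π ⟨$⟩ʳ b ]    ≡⟨ cong (λ z → map (π ⟨$⟩ʳ_) L ++ [ z ]) (transpose-source b y) ⟩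
        map (π ⟨$⟩ʳ_) L ++ [ y ]           ∎)
        where open ≡-Reasoning
      bottom-y : BottomIs y f
      bottom-y = Reachable-BottomIs {P = relabel π f}
                   (solvable (relabel π f) (relabel-IsState {m = m} {P = f} π f-state)) relabelled-bottom
      L′  = proj₁ bottom-y
      fp≡′ = proj₂ bottom-y

  two-piles-excluded : ∀ s (m : Vec ℕ (suc (suc s))) (f : Config w (suc (suc s))) →
    2 ≤ w → IsState m f → AlwaysSolvable m f → suc s ≢ 1
  two-piles-excluded zero    m f 2≤w f-state solvable refl = two-piles-unsolvable {m = m} {f} 2≤w f-state solvable
  two-piles-excluded (suc _) _ _ _   _       _        ()

  solvable⇒maxV-bound : ∀ (m : Vec ℕ (suc n)) (f : Config w (suc n)) →
    2 ≤ w → IsState m f → AlwaysSolvable m f → w + maxV m ≤ sumV m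
  solvable⇒maxV-bound m f 2≤w f-state solvable with w + maxV m ≤? sumV m
  ... | yes bound = bound
  ... | no ¬bound with maxV-attained m
  ... | p , mp≡max = contradiction solvable (Crowded.crowded-unsolvable m p crowded {f} 2≤w f-state)
    where
    crowded : sum (lookup m) < w + lookup m p
    crowded = subst₂ (λ a b → a < w + b) (sumV≡sum m) (sym mp≡max) (≰⇒> ¬bound)

theorem2 : (w s : ℕ) (m : Vec ℕ (suc s)) →
    1 ≤ w → 1 ≤ s → (∀ i → 1 ≤ lookup m i) → w ≤ sumV m →
    (f : Config w (suc s)) → IsState m f →
    (AlwaysSolvable m f ⇔ (w ≡ 1 ⊎ (1 < w × s ≢ 1 × w + maxV m ≤ sumV m)))
theorem2 w zero    m _   ()  _        _ f f-state
theorem2 w (suc s) m 1≤w _   positive _ f f-state = mk⇔ necessary sufficient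
  where
  necessary : AlwaysSolvable m f → w ≡ 1 ⊎ (1 < w × suc s ≢ 1 × w + maxV m ≤ sumV m)
  necessary solvable with w ≟ 1
  ... | yes w≡1 = inj₁ w≡1
  ... | no  w≢1 =
    inj₂ (1<w , two-piles-excluded s m f 1<w f-state solvable , solvable⇒maxV-bound m f 1<w f-state solvable)
    where 1<w = ≤∧≢⇒< 1≤w (w≢1 ∘ sym)

  sufficient : w ≡ 1 ⊎ (1 < w × suc s ≢ 1 × w + maxV m ≤ sumV m) → AlwaysSolvable m f
  sufficient (inj₁ refl)              = solvable m f (positive⇒Roomy₁ {m = m} positive) (inj₁ ≤-refl) f-state
  sufficient (inj₂ (_ , s≢0 , bound)) =
    solvable m f (maxV-bound⇒Roomy {m = m} bound)
      (inj₂ (subst (3 ≤_) (sym (positives-all {m = m} positive)) (three-piles s s≢0))) f-state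
    where
    three-piles : ∀ s → suc s ≢ 1 → 3 ≤ suc (suc s)
    three-piles zero    s≢0 = contradiction refl s≢0
    three-piles (suc _) _   = s≤s (s≤s (s≤s z≤n))
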